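{- Let $G$ be a cubic graph that admits a $\{K_3,P_4\}$-decomposition $D$. Then (a) no part of $D$ is isomorphic to $K_3$, and (b) no vertex of $G$ belongs to three distinct parts of $D$ that are isomorphic to $P_4$.
   Context: All graphs are finite, simple, connected and nontrivial. A graph is cubic if every vertex has degree $3$. $K_3$ is the triangle and $P_4$ the path on four vertices (three edges). A $\{K_3,P_4\}$-decomposition of $G$ is a partition of $E(G)$ into subgraphs (parts) each isomorphic to $K_3$ or $P_4$. -}

module Defs where

open import Data.Nat using (ℕ; _≤_)
open import Data.Fin using (Fin)
open import Data.List using (List; length; filter; allFin)
open import Data.Product using (_×_; Σ)
open import Data.Sum using (_⊎_)
open import Relation.Nullary using (¬_; Dec)
open import Relation.Binary.PropositionalEquality using (_≡_; _≢_)

record Graph (n : ℕ) : Set₁ where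
  field
    Adj    : Fin n → Fin n → Set
    adj?   : (x y : Fin n) → Dec (Adj x y)
    sym    : ∀ {x y} → Adj x y → Adj y x
    irrefl : ∀ {x} → ¬ Adj x x
open Graph public

degree : ∀ {n} → Graph n → Fin n → ℕ
degree G x = length (filter (adj? G x) (allFin _))

Cubic : ∀ {n} → Graph n → Set
Cubic G = ∀ x → degree G x ≡ 3

data Reach {n} (G : Graph n) : Fin n → Fin n → Set where
  here : ∀ {x} → Reach G x x
  step : ∀ {x y z} → Adj G x y → Reach G y z → Reach G x z

Connected : ∀ {n} → Graph n → Set
Connected {n} G = ∀ (x y : Fin n) → Reach G x y

Nontrivial : ∀ {n} → Graph n → Set
Nontrivial {n} _ = 2 ≤ n

data Part (n : ℕ) : Set where
  tri  : Fin n → Fin n → Fin n → Part n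
  path : Fin n → Fin n → Fin n → Fin n → Part n

-- The part is isomorphic to K3 (resp. P4): its vertices are pairwise distinct.
WellFormed : ∀ {n} → Part n → Set
WellFormed (tri a b c) = a ≢ b × a ≢ c × b ≢ c
WellFormed (path a b c d) = a ≢ b × a ≢ c × a ≢ d × b ≢ c × b ≢ d × c ≢ d

UEdge : ∀ {n} → Fin n → Fin n → Fin n → Fin n → Set
UEdge x y a b = (x ≡ a × y ≡ b) ⊎ (x ≡ b × y ≡ a)

EdgeIn : ∀ {n} → Part n → Fin n → Fin n → Set
EdgeIn (tri a b c) x y = UEdge x y a b ⊎ UEdge x y b c ⊎ UEdge x y a c
EdgeIn (path a b c d) x y = UEdge x y a b ⊎ UEdge x y b c ⊎ UEdge x y c d

VertexIn : ∀ {n} → Fin n → Part n → Set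
VertexIn v (tri a b c) = v ≡ a ⊎ v ≡ b ⊎ v ≡ c
VertexIn v (path a b c d) = v ≡ a ⊎ v ≡ b ⊎ v ≡ c ⊎ v ≡ d

IsTriangle : ∀ {n} → Part n → Set
IsTriangle (tri _ _ _) = Data.Unit.⊤ where import Data.Unit
IsTriangle (path _ _ _ _) = Data.Empty.⊥ where import Data.Empty

IsPath : ∀ {n} → Part n → Set
IsPath (tri _ _ _) = Data.Empty.⊥ where import Data.Empty
IsPath (path _ _ _ _) = Data.Unit.⊤ where import Data.Unit

record Decomposition {n} (G : Graph n) : Set where
  field
    m        : ℕ
    part     : Fin m → Part n
    wf       : ∀ i → WellFormed (part i)
    subgraph : ∀ i x y → EdgeIn (part i) x y → Adj G x y
    covers   : ∀ x y → Adj G x y → Σ (Fin m) (λ i → EdgeIn (part i) x y)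
    disjoint : ∀ x y i j → EdgeIn (part i) x y → EdgeIn (part j) x y → i ≡ j
open Decomposition public

-- Double counting.  Every part has exactly three edges and a cubic graph on
-- n vertices has 3n/2 edges, so there are exactly n/2 parts.  At a vertex a
-- part uses at most two of its three edges, so every vertex lies in at least
-- two parts, and the vertex-part incidences number at least 2n.  On the other
-- hand a part has at most four vertices, so there are at most 4 · n/2 = 2n
-- incidences.  Hence every part has exactly four vertices (no triangle) and
-- every vertex lies in exactly two parts.
module Submission where

open import Defs
open import Data.Nat using (ℕ; zero; suc; _+_; _*_; _≤_; _<_; z≤n; s≤s)
open import Data.Nat.Properties
  using (+-*-semiring; ≤-reflexive; ≤-antisym; <⇒≤; n≮n; ≮⇒≥; +-mono-≤; +-mono-<-≤; +-mono-≤-<; m≤m+n;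
         *-identityʳ; *-assoc; *-cancelʳ-≡; *-cancelˡ-<; module ≤-Reasoning)
open import Data.Nat.Tactic.RingSolver using (solve-∀)
open import Data.Fin using (Fin; zero; suc; _≟_; punchIn)
open import Data.Fin.Properties using (punchInᵢ≢i)
open import Data.Product using (_×_; ∃; _,_; proj₁; proj₂)
open import Data.Sum using (_⊎_; inj₁; inj₂; [_,_]′)
open import Data.Empty using (⊥; ⊥-elim)
open import Data.Unit using (tt)
open import Data.List using (length; filter; tabulate)
open import Function using (id; _∘_)
open import Relation.Nullary using (¬_; Dec; yes; no)
open import Relation.Nullary.Decidable using (_×-dec_; _⊎-dec_)
open import Relation.Unary using (Pred; Decidable; _⊆_)
open import Relation.Binary.PropositionalEquality as ≡
  using (_≡_; _≢_; refl; trans; cong; cong₂; subst; module ≡-Reasoning)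
open import Algebra.Properties.Semiring.Sum +-*-semiring
  using (sum-syntax; sum-cong-≗; sum-replicate-zero; sum-remove; ∑-distrib-+; ∑-comm; *-distribˡ-sum)

𝟙 : ∀ {a} {A : Set a} → Dec A → ℕ
𝟙 (yes _) = 1
𝟙 (no _)  = 0

module _ {a} {A : Set a} where

  𝟙-yes : A → (a? : Dec A) → 𝟙 a? ≡ 1
  𝟙-yes x (yes _) = refl
  𝟙-yes x (no ¬x) = ⊥-elim (¬x x)

  𝟙-no : ¬ A → (a? : Dec A) → 𝟙 a? ≡ 0
  𝟙-no ¬x (yes x) = ⊥-elim (¬x x)
  𝟙-no ¬x (no _)  = refl

module _ {a b} {A : Set a} {B : Set b} where

  𝟙-mono : (A → B) → (a? : Dec A) (b? : Dec B) → 𝟙 a? ≤ 𝟙 b?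
  𝟙-mono f (yes x) (yes _) = s≤s z≤n
  𝟙-mono f (yes x) (no ¬y) = ⊥-elim (¬y (f x))
  𝟙-mono f (no _)  b?      = z≤n

  𝟙-× : (a? : Dec A) (b? : Dec B) → 𝟙 (a? ×-dec b?) ≡ 𝟙 a? * 𝟙 b?
  𝟙-× (yes _) (yes _) = refl
  𝟙-× (yes _) (no _)  = refl
  𝟙-× (no _)  (yes _) = refl
  𝟙-× (no _)  (no _)  = refl

  𝟙-⊎ : ¬ (A × B) → (a? : Dec A) (b? : Dec B) → 𝟙 (a? ⊎-dec b?) ≡ 𝟙 a? + 𝟙 b?
  𝟙-⊎ excl (yes x) (yes y) = ⊥-elim (excl (x , y))
  𝟙-⊎ excl (yes _) (no _)  = refl
  𝟙-⊎ excl (no _)  (yes _) = refl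
  𝟙-⊎ excl (no _)  (no _)  = refl

exclusive-⊎ : ∀ {a b c} {A : Set a} {B : Set b} {C : Set c} →
              ¬ (A × B) → ¬ (A × C) → ¬ (A × (B ⊎ C))
exclusive-⊎ ¬ab ¬ac (x , inj₁ y) = ¬ab (x , y)
exclusive-⊎ ¬ab ¬ac (x , inj₂ z) = ¬ac (x , z)

apart : ∀ {a} {A : Set a} {x y z : A} → y ≢ z → ¬ (x ≡ y × x ≡ z)
apart y≢z (refl , refl) = y≢z refl

∑-const : ∀ n c → ∑[ i < n ] c ≡ n * c
∑-const zero    c = refl
∑-const (suc n) c = cong (c +_) (∑-const n c)

∑-mono-≤ : ∀ {n} {f g : Fin n → ℕ} → (∀ i → f i ≤ g i) → ∑[ i < n ] f i ≤ ∑[ i < n ] g i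
∑-mono-≤ {zero}  f≤g = z≤n
∑-mono-≤ {suc n} f≤g = +-mono-≤ (f≤g zero) (∑-mono-≤ (f≤g ∘ suc))

∑-mono-< : ∀ {n} {f g : Fin n → ℕ} → (∀ i → f i ≤ g i) → ∀ j → f j < g j →
           ∑[ i < n ] f i < ∑[ i < n ] g i
∑-mono-< f≤g zero    fj<gj = +-mono-<-≤ fj<gj (∑-mono-≤ (f≤g ∘ suc))
∑-mono-< f≤g (suc j) fj<gj = +-mono-≤-< (f≤g zero) (∑-mono-< (f≤g ∘ suc) j fj<gj)

module _ {n : ℕ} where

  count : ∀ {p} {P : Pred (Fin n) p} → Decidable P → ℕ
  count P? = ∑[ x < n ] 𝟙 (P? x)

  module _ {p q} {P : Pred (Fin n) p} {Q : Pred (Fin n) q} where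

    count-mono : P ⊆ Q → (P? : Decidable P) (Q? : Decidable Q) → count P? ≤ count Q?
    count-mono P⊆Q P? Q? = ∑-mono-≤ (λ x → 𝟙-mono P⊆Q (P? x) (Q? x))

    count-⊎ : (∀ x → ¬ (P x × Q x)) → (P? : Decidable P) (Q? : Decidable Q) →
              count (λ x → P? x ⊎-dec Q? x) ≡ count P? + count Q?
    count-⊎ excl P? Q? =
      trans (sum-cong-≗ (λ x → 𝟙-⊎ (excl x) (P? x) (Q? x))) (∑-distrib-+ {n} _ _)

  count-none : ∀ {p} {P : Pred (Fin n) p} → (∀ x → ¬ P x) → (P? : Decidable P) → count P? ≡ 0
  count-none ¬P P? = trans (sum-cong-≗ {n} (λ x → 𝟙-no (¬P x) (P? x))) (sum-replicate-zero n)

count-≟ : ∀ {n} (a : Fin n) → count (_≟ a) ≡ 1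
count-≟ {suc n} a = begin
  count (_≟ a)                                  ≡⟨ sum-remove {i = a} (λ x → 𝟙 (x ≟ a)) ⟩
  𝟙 (a ≟ a) + count (λ j → punchIn a j ≟ a)     ≡⟨ cong₂ _+_ (𝟙-yes refl (a ≟ a))
                                                             (count-none (punchInᵢ≢i a) (λ j → punchIn a j ≟ a)) ⟩
  1                                             ∎
  where open ≡-Reasoning

module _ {n : ℕ} {a b c : Fin n} (a≢b : a ≢ b) (a≢c : a ≢ c) (b≢c : b ≢ c) where

  𝟙-distinct₃ : ∀ x → 𝟙 (x ≟ a ⊎-dec (x ≟ b ⊎-dec x ≟ c)) ≡ 𝟙 (x ≟ a) + (𝟙 (x ≟ b) + 𝟙 (x ≟ c))
  𝟙-distinct₃ x = trans (𝟙-⊎ (exclusive-⊎ (apart a≢b) (apart a≢c)) (x ≟ a) _)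
                        (cong (𝟙 (x ≟ a) +_) (𝟙-⊎ (apart b≢c) (x ≟ b) (x ≟ c)))

  count-distinct₃ : count (λ x → x ≟ a ⊎-dec (x ≟ b ⊎-dec x ≟ c)) ≡ 3
  count-distinct₃ =
    trans (count-⊎ (λ x → exclusive-⊎ (apart a≢b) (apart a≢c)) (_≟ a) _)
          (cong₂ _+_ (count-≟ a)
                     (trans (count-⊎ (λ x → apart b≢c) (_≟ b) (_≟ c)) (cong₂ _+_ (count-≟ b) (count-≟ c))))

module _ {n : ℕ} {a b c d : Fin n} (a≢b : a ≢ b) (a≢c : a ≢ c) (a≢d : a ≢ d)
         (b≢c : b ≢ c) (b≢d : b ≢ d) (c≢d : c ≢ d) where

  private
    a-apart : ∀ {x} → ¬ (x ≡ a × (x ≡ b ⊎ (x ≡ c ⊎ x ≡ d)))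
    a-apart = exclusive-⊎ (apart a≢b) (exclusive-⊎ (apart a≢c) (apart a≢d))

  𝟙-distinct₄ : ∀ x → 𝟙 (x ≟ a ⊎-dec (x ≟ b ⊎-dec (x ≟ c ⊎-dec x ≟ d)))
                    ≡ 𝟙 (x ≟ a) + (𝟙 (x ≟ b) + (𝟙 (x ≟ c) + 𝟙 (x ≟ d)))
  𝟙-distinct₄ x = trans (𝟙-⊎ a-apart (x ≟ a) _) (cong (𝟙 (x ≟ a) +_) (𝟙-distinct₃ b≢c b≢d c≢d x))

  count-distinct₄ : count (λ x → x ≟ a ⊎-dec (x ≟ b ⊎-dec (x ≟ c ⊎-dec x ≟ d))) ≡ 4
  count-distinct₄ = trans (count-⊎ (λ x → a-apart) (_≟ a) _)
                          (cong₂ _+_ (count-≟ a) (count-distinct₃ b≢c b≢d c≢d))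

length-filter-tabulate : ∀ {a p} {A : Set a} {P : Pred A p} (P? : Decidable P) {n} (f : Fin n → A) →
                         length (filter P? (tabulate f)) ≡ ∑[ i < n ] 𝟙 (P? (f i))
length-filter-tabulate P? {zero}  f = refl
length-filter-tabulate P? {suc n} f with P? (f zero)
... | yes _ = cong suc (length-filter-tabulate P? (f ∘ suc))
... | no _  = length-filter-tabulate P? (f ∘ suc)

degree-≡-count : ∀ {n} (G : Graph n) x → degree G x ≡ count (adj? G x)
degree-≡-count G x = length-filter-tabulate (adj? G x) id

module _ {n : ℕ} where

  ue? : (x y a b : Fin n) → Dec (UEdge x y a b)
  ue? x y a b = (x ≟ a ×-dec y ≟ b) ⊎-dec (x ≟ b ×-dec y ≟ a)

  UEdge-unique : ∀ {x y a b c d : Fin n} → UEdge x y a b → UEdge x y c d → UEdge a b c d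
  UEdge-unique (inj₁ (refl , refl)) (inj₁ (refl , refl)) = inj₁ (refl , refl)
  UEdge-unique (inj₁ (refl , refl)) (inj₂ (refl , refl)) = inj₂ (refl , refl)
  UEdge-unique (inj₂ (refl , refl)) (inj₁ (refl , refl)) = inj₂ (refl , refl)
  UEdge-unique (inj₂ (refl , refl)) (inj₂ (refl , refl)) = inj₁ (refl , refl)

  incidence : Fin n → Fin n → Fin n → ℕ
  incidence v a b = 𝟙 (v ≟ a) + 𝟙 (v ≟ b)

  count-×-≟ : ∀ {a} {A : Set a} (a? : Dec A) (b : Fin n) → count (λ u → a? ×-dec u ≟ b) ≡ 𝟙 a?
  count-×-≟ a? b = begin
    count (λ u → a? ×-dec u ≟ b)   ≡⟨ sum-cong-≗ {n} (λ u → 𝟙-× a? (u ≟ b)) ⟩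
    ∑[ u < n ] (𝟙 a? * 𝟙 (u ≟ b))  ≡⟨ ≡.sym (*-distribˡ-sum {n} (𝟙 a?) _) ⟩
    𝟙 a? * count (_≟ b)             ≡⟨ cong (𝟙 a? *_) (count-≟ b) ⟩
    𝟙 a? * 1                        ≡⟨ *-identityʳ _ ⟩
    𝟙 a?                            ∎
    where open ≡-Reasoning

  count-UEdge : ∀ {v a b : Fin n} → a ≢ b → count (λ u → ue? v u a b) ≡ incidence v a b
  count-UEdge {v} {a} {b} a≢b =
    trans (count-⊎ excl (λ u → v ≟ a ×-dec u ≟ b) (λ u → v ≟ b ×-dec u ≟ a))
          (cong₂ _+_ (count-×-≟ (v ≟ a) b) (count-×-≟ (v ≟ b) a))
    where
    excl : ∀ u → ¬ ((v ≡ a × u ≡ b) × (v ≡ b × u ≡ a))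
    excl u ((v≡a , _) , (v≡b , _)) = apart a≢b (v≡a , v≡b)

  ∑-incidence : ∀ (a b : Fin n) → ∑[ v < n ] incidence v a b ≡ 2
  ∑-incidence a b = trans (∑-distrib-+ {n} _ _) (cong₂ _+_ (count-≟ a) (count-≟ b))

  ∑-incidence₃ : ∀ (a b c d e f : Fin n) →
                 ∑[ v < n ] (incidence v a b + (incidence v c d + incidence v e f)) ≡ 6
  ∑-incidence₃ a b c d e f =
    trans (∑-distrib-+ {n} _ _)
          (cong₂ _+_ (∑-incidence a b)
                     (trans (∑-distrib-+ {n} _ _) (cong₂ _+_ (∑-incidence c d) (∑-incidence e f))))

module _ {n : ℕ} {a b c d e f : Fin n} (a≢b : a ≢ b) (c≢d : c ≢ d) (e≢f : e ≢ f)
         (ab≠cd : ¬ UEdge a b c d) (ab≠ef : ¬ UEdge a b e f) (cd≠ef : ¬ UEdge c d e f) where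

  count-three-edges : ∀ v → count (λ u → ue? v u a b ⊎-dec (ue? v u c d ⊎-dec ue? v u e f))
                          ≡ incidence v a b + (incidence v c d + incidence v e f)
  count-three-edges v =
    trans (count-⊎ (λ u → exclusive-⊎ (separate ab≠cd) (separate ab≠ef))
                   (λ u → ue? v u a b) (λ u → ue? v u c d ⊎-dec ue? v u e f))
          (cong₂ _+_ (count-UEdge a≢b)
                     (trans (count-⊎ (λ u → separate cd≠ef) (λ u → ue? v u c d) (λ u → ue? v u e f))
                            (cong₂ _+_ (count-UEdge c≢d) (count-UEdge e≢f))))
    where
    separate : ∀ {u a b c d} → ¬ UEdge a b c d → ¬ (UEdge v u a b × UEdge v u c d)
    separate distinct (e₁ , e₂) = distinct (UEdge-unique e₁ e₂)

module _ {n : ℕ} where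

  edge? : (p : Part n) (x y : Fin n) → Dec (EdgeIn p x y)
  edge? (tri a b c)    x y = ue? x y a b ⊎-dec (ue? x y b c ⊎-dec ue? x y a c)
  edge? (path a b c d) x y = ue? x y a b ⊎-dec (ue? x y b c ⊎-dec ue? x y c d)

  vin? : (v : Fin n) (p : Part n) → Dec (VertexIn v p)
  vin? v (tri a b c)    = v ≟ a ⊎-dec (v ≟ b ⊎-dec v ≟ c)
  vin? v (path a b c d) = v ≟ a ⊎-dec (v ≟ b ⊎-dec (v ≟ c ⊎-dec v ≟ d))

  degreeIn : Part n → Fin n → ℕ
  degreeIn p v = count (edge? p v)

  order : Part n → ℕ
  order p = count (λ v → vin? v p)

  incidences : Part n → Fin n → ℕ
  incidences (tri a b c)    v = incidence v a b + (incidence v b c + incidence v a c)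
  incidences (path a b c d) v = incidence v a b + (incidence v b c + incidence v c d)

  degreeIn-≡-incidences : (p : Part n) → WellFormed p → ∀ v → degreeIn p v ≡ incidences p v
  degreeIn-≡-incidences (tri a b c) (a≢b , a≢c , b≢c) =
    count-three-edges a≢b b≢c a≢c
      [ a≢b ∘ proj₁ , a≢c ∘ proj₁ ]′ [ b≢c ∘ proj₂ , a≢c ∘ proj₁ ]′ [ a≢b ∘ ≡.sym ∘ proj₁ , b≢c ∘ proj₁ ]′
  degreeIn-≡-incidences (path a b c d) (a≢b , a≢c , a≢d , b≢c , b≢d , c≢d) =
    count-three-edges a≢b b≢c c≢d
      [ a≢b ∘ proj₁ , a≢c ∘ proj₁ ]′ [ a≢c ∘ proj₁ , a≢d ∘ proj₁ ]′ [ b≢c ∘ proj₁ , b≢d ∘ proj₁ ]′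

  ∑-degreeIn : (p : Part n) → WellFormed p → ∑[ v < n ] degreeIn p v ≡ 6
  ∑-degreeIn p wf = trans (sum-cong-≗ {n} (degreeIn-≡-incidences p wf)) (∑-incidences p)
    where
    ∑-incidences : (p : Part n) → ∑[ v < n ] incidences p v ≡ 6
    ∑-incidences (tri a b c)    = ∑-incidence₃ a b b c a c
    ∑-incidences (path a b c d) = ∑-incidence₃ a b b c c d

  degreeIn-≤ : (p : Part n) → WellFormed p → ∀ v → degreeIn p v ≤ 2 * 𝟙 (vin? v p)
  degreeIn-≤ p@(tri a b c) wf@(a≢b , a≢c , b≢c) v = begin
    degreeIn p v                              ≡⟨ degreeIn-≡-incidences p wf v ⟩
    incidences p v                            ≡⟨ triangle-identity (𝟙 (v ≟ a)) (𝟙 (v ≟ b)) (𝟙 (v ≟ c)) ⟩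
    2 * (𝟙 (v ≟ a) + (𝟙 (v ≟ b) + 𝟙 (v ≟ c))) ≡⟨ cong (2 *_) (𝟙-distinct₃ a≢b a≢c b≢c v) ⟨
    2 * 𝟙 (vin? v p)                          ∎
    where
    open ≤-Reasoning
    triangle-identity : ∀ x y z → (x + y) + ((y + z) + (x + z)) ≡ 2 * (x + (y + z))
    triangle-identity = solve-∀
  degreeIn-≤ p@(path a b c d) wf@(a≢b , a≢c , a≢d , b≢c , b≢d , c≢d) v = begin
    degreeIn p v                               ≡⟨ degreeIn-≡-incidences p wf v ⟩
    incidences p v                             ≤⟨ path-bound (𝟙 (v ≟ a)) (𝟙 (v ≟ b)) (𝟙 (v ≟ c)) (𝟙 (v ≟ d)) ⟩
    2 * (𝟙 (v ≟ a) + (𝟙 (v ≟ b) + (𝟙 (v ≟ c) + 𝟙 (v ≟ d))))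
                                               ≡⟨ cong (2 *_) (𝟙-distinct₄ a≢b a≢c a≢d b≢c b≢d c≢d v) ⟨
    2 * 𝟙 (vin? v p)                           ∎
    where
    open ≤-Reasoning
    path-identity : ∀ w x y z → (w + x) + ((x + y) + (y + z)) + (w + z) ≡ 2 * (w + (x + (y + z)))
    path-identity = solve-∀
    path-bound : ∀ w x y z → (w + x) + ((x + y) + (y + z)) ≤ 2 * (w + (x + (y + z)))
    path-bound w x y z = subst ((w + x) + ((x + y) + (y + z)) ≤_) (path-identity w x y z) (m≤m+n _ (w + z))

  order-triangle : (p : Part n) → WellFormed p → IsTriangle p → order p < 4
  order-triangle (tri a b c) (a≢b , a≢c , b≢c) _ = ≤-reflexive (cong suc (count-distinct₃ a≢b a≢c b≢c))

  order-≤ : (p : Part n) → WellFormed p → order p ≤ 4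
  order-≤ p@(tri _ _ _)  wf = <⇒≤ (order-triangle p wf tt)
  order-≤ (path a b c d) (a≢b , a≢c , a≢d , b≢c , b≢d , c≢d) =
    ≤-reflexive (count-distinct₄ a≢b a≢c a≢d b≢c b≢d c≢d)

module _ {n : ℕ} {G : Graph n} (cubic : Cubic G) (D : Decomposition G) where

  count-parts-with-edge : ∀ x y → count (λ i → edge? (part D i) x y) ≡ 𝟙 (adj? G x y)
  count-parts-with-edge x y with adj? G x y
  ... | no ¬xy = count-none (λ i e → ¬xy (subgraph D i x y e)) (λ i → edge? (part D i) x y)
  ... | yes xy with covers D x y xy
  ...   | i , e = trans (≤-antisym (count-mono (λ e′ → disjoint D x y _ i e′ e) parts? (_≟ i))
                                   (count-mono (λ { refl → e }) (_≟ i) parts?))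
                        (count-≟ i)
    where
    parts? : Decidable (λ j → EdgeIn (part D j) x y)
    parts? j = edge? (part D j) x y

  degree-≡-∑-degreeIn : ∀ v → degree G v ≡ ∑[ i < m D ] degreeIn (part D i) v
  degree-≡-∑-degreeIn v = begin
    degree G v                                         ≡⟨ degree-≡-count G v ⟩
    count (adj? G v)                                   ≡⟨ sum-cong-≗ {n} (≡.sym ∘ count-parts-with-edge v) ⟩
    ∑[ u < n ] ∑[ i < m D ] 𝟙 (edge? (part D i) v u)   ≡⟨ ∑-comm {n} {m D} _ ⟩
    ∑[ i < m D ] degreeIn (part D i) v                 ∎
    where open ≡-Reasoning

  vertices-≡-twice-parts : n ≡ m D * 2
  vertices-≡-twice-parts = *-cancelʳ-≡ n (m D * 2) 3 (begin
    n * 3                                              ≡⟨ ∑-const n 3 ⟨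
    ∑[ v < n ] 3                                       ≡⟨ sum-cong-≗ {n} (λ v → trans (≡.sym (cubic v)) (degree-≡-∑-degreeIn v)) ⟩
    ∑[ v < n ] ∑[ i < m D ] degreeIn (part D i) v      ≡⟨ ∑-comm {n} {m D} _ ⟩
    ∑[ i < m D ] ∑[ v < n ] degreeIn (part D i) v      ≡⟨ sum-cong-≗ {m D} (λ i → ∑-degreeIn (part D i) (wf D i)) ⟩
    ∑[ i < m D ] 6                                     ≡⟨ ∑-const (m D) 6 ⟩
    m D * 6                                            ≡⟨ *-assoc (m D) 2 3 ⟨
    m D * 2 * 3                                        ∎)
    where open ≡-Reasoning

  partsAt : Fin n → ℕ
  partsAt v = count (λ i → vin? v (part D i))

  partsAt-≥-2 : ∀ v → 2 ≤ partsAt v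
  partsAt-≥-2 v = *-cancelˡ-< 2 1 (partsAt v) (begin
    3                                                  ≡⟨ cubic v ⟨
    degree G v                                         ≡⟨ degree-≡-∑-degreeIn v ⟩
    ∑[ i < m D ] degreeIn (part D i) v                 ≤⟨ ∑-mono-≤ (λ i → degreeIn-≤ (part D i) (wf D i) v) ⟩
    ∑[ i < m D ] (2 * 𝟙 (vin? v (part D i)))           ≡⟨ *-distribˡ-sum {m D} 2 _ ⟨
    2 * partsAt v                                      ∎)
    where open ≤-Reasoning

  ∑-partsAt-≡-∑-order : ∑[ v < n ] partsAt v ≡ ∑[ i < m D ] order (part D i)
  ∑-partsAt-≡-∑-order = ∑-comm {n} {m D} _

  ∑-four-≡ : ∑[ i < m D ] 4 ≡ n * 2
  ∑-four-≡ = begin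
    ∑[ i < m D ] 4   ≡⟨ ∑-const (m D) 4 ⟩
    m D * 4          ≡⟨ *-assoc (m D) 2 2 ⟨
    m D * 2 * 2      ≡⟨ cong (_* 2) vertices-≡-twice-parts ⟨
    n * 2            ∎
    where open ≡-Reasoning

  ∑-partsAt : ∑[ v < n ] partsAt v ≡ n * 2
  ∑-partsAt = ≤-antisym at-most at-least
    where
    open ≤-Reasoning
    at-most : ∑[ v < n ] partsAt v ≤ n * 2
    at-most = begin
      ∑[ v < n ] partsAt v             ≡⟨ ∑-partsAt-≡-∑-order ⟩
      ∑[ i < m D ] order (part D i)    ≤⟨ ∑-mono-≤ (λ i → order-≤ (part D i) (wf D i)) ⟩
      ∑[ i < m D ] 4                   ≡⟨ ∑-four-≡ ⟩
      n * 2                            ∎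
    at-least : n * 2 ≤ ∑[ v < n ] partsAt v
    at-least = begin
      n * 2                            ≡⟨ ∑-const n 2 ⟨
      ∑[ v < n ] 2                     ≤⟨ ∑-mono-≤ partsAt-≥-2 ⟩
      ∑[ v < n ] partsAt v             ∎

  triangle-free : ∀ i → ¬ IsTriangle (part D i)
  triangle-free i t = n≮n (n * 2) (begin-strict
    n * 2                            ≡⟨ ∑-partsAt ⟨
    ∑[ v < n ] partsAt v             ≡⟨ ∑-partsAt-≡-∑-order ⟩
    ∑[ j < m D ] order (part D j)    <⟨ ∑-mono-< (λ j → order-≤ (part D j) (wf D j)) i
                                                (order-triangle (part D i) (wf D i) t) ⟩
    ∑[ j < m D ] 4                   ≡⟨ ∑-four-≡ ⟩
    n * 2                            ∎)
    where open ≤-Reasoning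

  partsAt-≤-2 : ∀ v → partsAt v ≤ 2
  partsAt-≤-2 v = ≮⇒≥ λ 2<partsAt → n≮n (n * 2) (begin-strict
    n * 2                            ≡⟨ ∑-const n 2 ⟨
    ∑[ u < n ] 2                     <⟨ ∑-mono-< partsAt-≥-2 v 2<partsAt ⟩
    ∑[ u < n ] partsAt u             ≡⟨ ∑-partsAt ⟩
    n * 2                            ∎)
    where open ≤-Reasoning

  not-in-three-parts : ∀ {v i j k} → i ≢ j → i ≢ k → j ≢ k →
                       VertexIn v (part D i) → VertexIn v (part D j) → VertexIn v (part D k) → ⊥
  not-in-three-parts {v} {i} {j} {k} i≢j i≢k j≢k v∈i v∈j v∈k = n≮n 2 (begin-strict
    2                                                        <⟨ s≤s (s≤s (s≤s z≤n)) ⟩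
    3                                                        ≡⟨ count-distinct₃ i≢j i≢k j≢k ⟨
    count (λ x → x ≟ i ⊎-dec (x ≟ j ⊎-dec x ≟ k))            ≤⟨ count-mono containing (λ x → x ≟ i ⊎-dec (x ≟ j ⊎-dec x ≟ k))
                                                                                     (λ x → vin? v (part D x)) ⟩
    partsAt v                                                ≤⟨ partsAt-≤-2 v ⟩
    2                                                        ∎)
    where
    open ≤-Reasoning
    containing : ∀ {x} → x ≡ i ⊎ (x ≡ j ⊎ x ≡ k) → VertexIn v (part D x)
    containing (inj₁ refl)        = v∈i
    containing (inj₂ (inj₁ refl)) = v∈j
    containing (inj₂ (inj₂ refl)) = v∈k

proposition1 : ∀ {n} (G : Graph n) → Connected G → Nontrivial G → Cubic G
               → (D : Decomposition G)
               → (∀ i → ¬ IsTriangle (part D i))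
                 × (∀ (v : Fin n) → ¬ (∃ λ i → ∃ λ j → ∃ λ k →
                      i ≢ j × i ≢ k × j ≢ k
                      × IsPath (part D i) × IsPath (part D j) × IsPath (part D k)
                      × VertexIn v (part D i) × VertexIn v (part D j) × VertexIn v (part D k)))
proposition1 G _ _ cubic D =
  triangle-free cubic D ,
  λ { v (i , j , k , i≢j , i≢k , j≢k , _ , _ , _ , v∈i , v∈j , v∈k) →
        not-in-three-parts cubic D i≢j i≢k j≢k v∈i v∈j v∈k }
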